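{- For any monoid $M$, the map $\mathrm{R}:\mathbf{P}(M)\to\mathbf{P}(M)$ sending each pigmented word $\mathfrak{p}(1)\cdots\mathfrak{p}(\ell)$ to its mirror image $\mathfrak{p}(\ell)\cdots\mathfrak{p}(1)$ (same arity) is an involutive clone automorphism of $\mathbf{P}(M)$.
   Context: A clone is a graded set with superposition maps $C(n)\times C(m)^n\to C(m)$ and projections $\mathbf{1}_{i,n}$ satisfying the usual clone axioms; a clone automorphism is a bijective arity-preserving map preserving projections and superposition. For a monoid $(M,\cdot,e)$: an $M$-pigmented letter is a pair $i^\alpha$ ($i\ge1$ an integer, $\alpha\in M$); $\mathbf{P}(M)(n)$ is the set of words of $M$-pigmented letters with values in $[n]$. For $\alpha\in M$, $\alpha\odot i_1^{\alpha_1}\cdots i_\ell^{\alpha_\ell}:=i_1^{\alpha\cdot\alpha_1}\cdots i_\ell^{\alpha\cdot\alpha_\ell}$. The clone $\mathbf{P}(M)$ has superposition $i_1^{\alpha_1}\cdots i_\ell^{\alpha_\ell}[\mathfrak{p}_1,\dots,\mathfrak{p}_n]:=(\alpha_1\odot\mathfrak{p}_{i_1})\cdots(\alpha_\ell\odot\mathfrak{p}_{i_\ell})$ and projections $\mathbf{1}_{i,n}:=i^e$. -}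

module Defs where

open import Level using (Level; _⊔_; suc; Lift)
open import Algebra.Bundles using (Monoid)
open import Data.Nat using (ℕ)
open import Data.Fin using (Fin)
open import Data.Product using (_×_; _,_; Σ)
open import Data.List using (List; []; _∷_; _++_; map; concatMap; reverse)
open import Data.List.Relation.Binary.Pointwise using (Pointwise)
open import Relation.Binary.PropositionalEquality using (_≡_)

-- The data of a clone: graded carrier with an equality (setoid-style, since
-- the pigments come from a setoid-based monoid), superposition and projections.
-- (The clone axioms are not needed to define automorphisms.)
record CloneData (c ℓ : Level) : Set (Level.suc (c ⊔ ℓ)) where
  field
    C      : ℕ → Set c
    _≈C_   : ∀ {n} → C n → C n → Set ℓ
    sup    : ∀ {n m} → C n → (Fin n → C m) → C m
    proj   : ∀ {n} → Fin n → C n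

record IsCloneAutomorphism {c ℓ} (K : CloneData c ℓ)
    (φ : ∀ {n} → CloneData.C K n → CloneData.C K n) : Set (c ⊔ ℓ) where
  open CloneData K
  field
    cong-φ     : ∀ {n} {x y : C n} → x ≈C y → φ x ≈C φ y
    injective  : ∀ {n} {x y : C n} → φ x ≈C φ y → x ≈C y
    surjective : ∀ {n} (y : C n) → Σ (C n) (λ x → φ x ≈C y)
    pres-proj  : ∀ {n} (i : Fin n) → φ (proj i) ≈C proj i
    pres-sup   : ∀ {n m} (x : C n) (ys : Fin n → C m) →
                 φ (sup x ys) ≈C sup (φ x) (λ i → φ (ys i))

module Pigmented {c ℓ} (M : Monoid c ℓ) where
  open Monoid M renaming (Carrier to A)

  Letter : ℕ → Set c
  Letter n = Fin n × A

  Word : ℕ → Set c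
  Word n = List (Letter n)

  LetterEq : ∀ {n} → Letter n → Letter n → Set (c ⊔ ℓ)
  LetterEq (i , α) (j , β) = Lift c (i ≡ j) × (α ≈ β)

  _≈W_ : ∀ {n} → Word n → Word n → Set (c ⊔ ℓ)
  _≈W_ = Pointwise LetterEq

  _⊙_ : ∀ {n} → A → Word n → Word n
  α ⊙ w = map (λ { (i , β) → (i , α ∙ β) }) w

  subst : ∀ {n m} → Word n → (Fin n → Word m) → Word m
  subst w ps = concatMap (λ { (i , α) → α ⊙ ps i }) w

  P : CloneData c (c ⊔ ℓ)
  P = record
    { C    = Word
    ; _≈C_ = _≈W_
    ; sup  = subst
    ; proj = λ i → (i , ε) ∷ []
    }

  R : ∀ {n} → Word n → Word n
  R = reverse

{-# OPTIONS --safe #-}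
module Submission where

open import Defs
open import Level using (Level; lift)
open import Algebra.Bundles using (Monoid)
open import Data.Product using (_×_; _,_)
open import Data.Fin using (Fin)
open import Function using (_∘_)
open import Data.List using (List; []; _∷_; _++_; [_]; concatMap; reverse)
open import Data.List.Properties
  using (concatMap-++; concatMap-cong; reverse-++; unfold-reverse; ++-identityʳ;
         reverse-map; reverse-involutive)
import Data.List.Relation.Binary.Pointwise as Pointwise
open import Relation.Binary.Structures using (IsEquivalence)
open import Relation.Binary.PropositionalEquality
  using (_≡_; refl; sym; cong; module ≡-Reasoning)

-- Reversal is an anti-homomorphism for concatenation, hence also for superposition,
-- whose word is the concatenation of the pigmented substituted words; pigmenting
-- commutes with reversal because it acts letterwise.

reverse-concatMap : ∀ {a b} {A : Set a} {B : Set b} (f : A → List B) (xs : List A) →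
  reverse (concatMap f xs) ≡ concatMap (reverse ∘ f) (reverse xs)
reverse-concatMap f [] = refl
reverse-concatMap f (x ∷ xs) = begin
  reverse (f x ++ concatMap f xs)
    ≡⟨ reverse-++ (f x) (concatMap f xs) ⟩
  reverse (concatMap f xs) ++ reverse (f x)
    ≡⟨ cong (_++ reverse (f x)) (reverse-concatMap f xs) ⟩
  concatMap g (reverse xs) ++ g x
    ≡⟨ cong (concatMap g (reverse xs) ++_) (++-identityʳ (g x)) ⟨
  concatMap g (reverse xs) ++ concatMap g [ x ]
    ≡⟨ concatMap-++ g (reverse xs) [ x ] ⟨
  concatMap g (reverse xs ++ [ x ])
    ≡⟨ cong (concatMap g) (unfold-reverse x xs) ⟨
  concatMap g (reverse (x ∷ xs))
    ∎
  where
  open ≡-Reasoning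
  g = reverse ∘ f

module _ {c ℓ : Level} (M : Monoid c ℓ) where
  open Monoid M using () renaming (Carrier to A)
  open Pigmented M

  letterEq-isEquivalence : ∀ {n} → IsEquivalence (LetterEq {n})
  letterEq-isEquivalence = record
    { refl  = lift refl , M.refl
    ; sym   = λ { (lift refl , α≈β) → lift refl , M.sym α≈β }
    ; trans = λ { (lift refl , α≈β) (lift refl , β≈γ) → lift refl , M.trans α≈β β≈γ }
    }
    where module M = Monoid M

  ≈W-isEquivalence : ∀ {n} → IsEquivalence (_≈W_ {n})
  ≈W-isEquivalence = Pointwise.isEquivalence letterEq-isEquivalence

  ≡⇒≈W : ∀ {n} {v w : Word n} → v ≡ w → v ≈W w
  ≡⇒≈W refl = IsEquivalence.refl ≈W-isEquivalence

  R-involutive : ∀ {n} (w : Word n) → R (R w) ≈W w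
  R-involutive w = ≡⇒≈W (reverse-involutive w)

  R-injective : ∀ {n} {v w : Word n} → R v ≈W R w → v ≈W w
  R-injective {v = v} {w} Rv≈Rw =
    ≈W.trans (≈W.sym (R-involutive v)) (≈W.trans (Pointwise.reverse⁺ Rv≈Rw) (R-involutive w))
    where module ≈W = IsEquivalence ≈W-isEquivalence

  R-⊙ : ∀ {n} (α : A) (w : Word n) → R (α ⊙ w) ≡ α ⊙ R w
  R-⊙ α w = sym (reverse-map _ w)

  R-subst : ∀ {n m} (w : Word n) (ps : Fin n → Word m) →
    R (subst w ps) ≡ subst (R w) (R ∘ ps)
  R-subst w ps = begin
    reverse (concatMap (λ { (i , α) → α ⊙ ps i }) w)
      ≡⟨ reverse-concatMap _ w ⟩
    concatMap (λ { (i , α) → reverse (α ⊙ ps i) }) (reverse w)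
      ≡⟨ concatMap-cong (λ { (i , α) → R-⊙ α (ps i) }) (reverse w) ⟩
    subst (R w) (R ∘ ps)
      ∎
    where open ≡-Reasoning

  R-isCloneAutomorphism : IsCloneAutomorphism P R
  R-isCloneAutomorphism = record
    { cong-φ     = Pointwise.reverse⁺
    ; injective  = R-injective
    ; surjective = λ w → R w , R-involutive w
    ; pres-proj  = λ i → ≡⇒≈W refl
    ; pres-sup   = λ w ps → ≡⇒≈W (R-subst w ps)
    }

proposition3p2p3 : ∀ {c ℓ : Level} (M : Monoid c ℓ) →
    IsCloneAutomorphism (Pigmented.P M) (Pigmented.R M)
      × (∀ {n} (w : Pigmented.Word M n) → Pigmented._≈W_ M (Pigmented.R M (Pigmented.R M w)) w)
proposition3p2p3 M = R-isCloneAutomorphism M , R-involutive M
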